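{- Consider the data dependent tree (DDT) on a string of length $n$, and let $d_1, \ldots, d_k$ be the duplicate nodes on the path from the root to some leaf. Then $\sum_{i=1}^k \log \deg(d_i) = O(\log n)$, where $\deg(d_i)$ is the number of children of $d_i$.
   Context: Data dependent tree (DDT). Fix a hash function $h$ with outputs that are $c\log n$-bit integers; the value $h(v)$ of a node $v$ is called its hash. Given a string $x_1 \cdots x_n$, level $0$ consists of $n$ leaves, in left-to-right order, with the $j$-th leaf storing $x_j$ and having hash $h(x_j)$. Levels $\ell = 1,2,3,\ldots$ alternate between duplicate levels and increasing levels, level $1$ being a duplicate level. Each level is built from the left-to-right sequence of nodes at level $\ell-1$ by cutting that sequence into consecutive groups, each group becoming the ordered children of one new node at level $\ell$: - If $\ell$ is a duplicate level, the groups are the maximal consecutive runs of nodes having equal hashes. The new node (a duplicate node) with $k$ children $c_1,\dots,c_k$ gets hash $h(\langle \ell, k, h(c_1)\rangle)$. - If $\ell$ is an increasing level, the groups are the maximal consecutive runs of nodes with strictly increasing hashes. The new node (an increasing node) with children $c_1,\dots,c_k$ gets hash $h(\langle \ell, h(c_1),\ldots,h(c_k)\rangle)$. The structure is maintained so that $h$ never maps two distinct inputs it has been applied to to the same value (a new $h$ is chosen and the tree is rebuilt upon a collision). Consequently, two nodes have equal hashes if and only if the substrings spelled by the leaves of their subtrees are equal. -}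

module Defs where

open import Data.Nat using (ℕ; zero; suc; _*_; _≡ᵇ_; _<ᵇ_)
open import Data.Bool using (Bool; true; false; if_then_else_)
open import Data.List using (List; []; _∷_; map; length; product; foldr)
open import Data.List.NonEmpty as L⁺ using (List⁺; _∷_; _∷⁺_; toList)
open import Data.List.Membership.Propositional using (_∈_)
open import Data.Vec as Vec using (Vec)

-- Inputs to which the hash function h is applied:
--   chr a          : a leaf character x_j
--   dupI ℓ k h₁    : the tuple ⟨ℓ, k, h(c₁)⟩ of a duplicate node
--   incI ℓ [h₁..hₖ] : the tuple ⟨ℓ, h(c₁), …, h(cₖ)⟩ of an increasing node
data HInput (A : Set) : Set where
  chr  : A → HInput A
  dupI : ℕ → ℕ → ℕ → HInput A
  incI : ℕ → List ℕ → HInput A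

data Kind : Set where
  dupK incK : Kind

data Node (A : Set) : Set where
  leaf  : A → ℕ → Node A
  inner : Kind → HInput A → ℕ → List (Node A) → Node A

module _ {A : Set} where

  hashOf : Node A → ℕ
  hashOf (leaf _ x) = x
  hashOf (inner _ _ x _) = x

  inputOf : Node A → HInput A
  inputOf (leaf a _) = chr a
  inputOf (inner _ i _ _) = i

  degree : Node A → ℕ
  degree (leaf _ _) = 0
  degree (inner _ _ _ cs) = length cs

groupRuns : {X : Set} → (X → X → Bool) → List X → List (List⁺ X)
groupRuns R [] = []
groupRuns R (x ∷ xs) with groupRuns R xs
... | [] = (x ∷ []) ∷ []
... | g ∷ gs = if R x (L⁺.head g) then (x ∷⁺ g) ∷ gs else (x ∷ []) ∷ g ∷ gs

isDupLevel : ℕ → Bool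
isDupLevel zero = false
isDupLevel (suc zero) = true
isDupLevel (suc (suc n)) = isDupLevel n

module _ {A : Set} (h : HInput A → ℕ) where

  dupNode : ℕ → List⁺ (Node A) → Node A
  dupNode ℓ g = inner dupK i (h i) (toList g)
    where i = dupI ℓ (length (toList g)) (hashOf (L⁺.head g))

  incNode : ℕ → List⁺ (Node A) → Node A
  incNode ℓ g = inner incK i (h i) (toList g)
    where i = incI ℓ (map hashOf (toList g))

  buildLevel : ℕ → List (Node A) → List (Node A)
  buildLevel ℓ xs with isDupLevel ℓ
  ... | true  = map (dupNode ℓ) (groupRuns (λ u v → hashOf u ≡ᵇ hashOf v) xs)
  ... | false = map (incNode ℓ) (groupRuns (λ u v → hashOf u <ᵇ hashOf v) xs)

  leaves : {n : ℕ} → Vec A n → List (Node A)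
  leaves s = map (λ a → leaf a (h (chr a))) (Vec.toList s)

  level : {n : ℕ} → Vec A n → ℕ → List (Node A)
  level s zero = leaves s
  level s (suc ℓ) = buildLevel (suc ℓ) (level s ℓ)

data RootLeafPath {A : Set} : Node A → List (Node A) → Set where
  atLeaf : ∀ {a x} → RootLeafPath (leaf a x) (leaf a x ∷ [])
  down   : ∀ {k i x cs c p} → c ∈ cs → RootLeafPath c p →
           RootLeafPath (inner k i x cs) (inner k i x cs ∷ p)

isDupNode : {A : Set} → Node A → Bool
isDupNode (inner dupK _ _ _) = true
isDupNode _ = false

dupDegreeProduct : {A : Set} → List (Node A) → ℕ
dupDegreeProduct = foldr (λ u r → if isDupNode u then degree u * r else r) 1

module Submission where

-- Let the width of a node be the number of leaves below it,
-- i.e. the length of the substring it spells.  We prove the stronger bound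
-- ∏ deg(dᵢ) ≤ n (so C = 1, equivalently Σ log deg(dᵢ) ≤ log n):
--   * every level of the DDT has total width n, since building a level only
--     regroups the nodes of the previous one;
--   * collision-freeness of h makes the hash of a node determine its width
--     (induction on the level: equal hashes force equal hash inputs, i.e.
--     equal (degree, first-child hash) or equal children-hash lists);
--   * hence the children of a duplicate node, which share one hash, all have
--     the same width w, so a duplicate node of degree k has width k · w;
--   * along a root-to-leaf path in any tree whose duplicate nodes have
--     children of equal width, the product of the duplicate degrees is at
--     most the width of the top node — here the root, of width n.

open import Defs
open import Data.Nat using (ℕ; _≤_; _<_; _^_; _*_)
open import Data.Nat.Logarithm using (⌈log₂_⌉)
open import Data.List using (List; _∷_; []; length)
open import Data.List.Membership.Propositional using (_∈_)
open import Data.Vec using (Vec)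
open import Data.Product using (∃; ∃-syntax; _×_)
open import Relation.Binary.PropositionalEquality using (_≡_; _≢_)

open import Data.Nat using (zero; suc; _+_; _≡ᵇ_; _<ᵇ_)
open import Data.Nat.Properties
  using (≤-refl; ≤-trans; m≤m+n; m≤n+m; n≤1+n; +-assoc; +-identityʳ; *-monoʳ-≤; *-identityʳ; ≡ᵇ⇒≡)
open import Data.Bool using (Bool; true; false; T)
open import Data.Bool.Properties using (T-≡)
open import Data.Unit using (⊤)
open import Data.List using (map; concat; _++_)
open import Data.List.Properties using (∷-injectiveˡ; ∷-injectiveʳ)
open import Data.List.NonEmpty as L⁺ using (List⁺; toList)
open import Data.List.Relation.Unary.All as All using (All; []; _∷_)
open import Data.List.Relation.Unary.Linked using (Linked; []; [-]; _∷_)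
open import Data.List.Relation.Unary.Any using (here; there)
open import Data.List.Membership.Propositional.Properties using (∈-map⁺; ∈-map⁻; ∈-concat⁺′)
open import Data.Product using (_,_)
open import Function.Bundles using (Equivalence)
open import Relation.Binary.PropositionalEquality
  using (refl; sym; trans; cong; cong₂; subst; module ≡-Reasoning)
import Data.Vec as Vec

module _ {X : Set} (R : X → X → Bool) where

  groupRuns-concat : ∀ xs → concat (map toList (groupRuns R xs)) ≡ xs
  groupRuns-concat [] = refl
  groupRuns-concat (x ∷ xs) with groupRuns R xs | groupRuns-concat xs
  ... | [] | ih = cong (x ∷_) ih
  ... | g ∷ gs | ih with R x (L⁺.head g)
  ...   | true = cong (x ∷_) ih
  ...   | false = cong (x ∷_) ih

  groupRuns-∈ : ∀ xs {g y} → g ∈ groupRuns R xs → y ∈ toList g → y ∈ xs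
  groupRuns-∈ xs g∈gs y∈g =
    subst (_ ∈_) (groupRuns-concat xs) (∈-concat⁺′ y∈g (∈-map⁺ toList g∈gs))

  groupRuns-linked : ∀ xs → All (λ g → Linked (λ a b → T (R a b)) (toList g)) (groupRuns R xs)
  groupRuns-linked [] = []
  groupRuns-linked (x ∷ xs) with groupRuns R xs | groupRuns-linked xs
  ... | [] | _ = [-] ∷ []
  ... | (z L⁺.∷ zs) ∷ gs | run ∷ runs with R x z in Rxz
  ...   | true = (Equivalence.from T-≡ Rxz ∷ run) ∷ runs
  ...   | false = [-] ∷ run ∷ runs

linked-constant : ∀ {X : Set} {R : X → X → Set} (f : X → ℕ) →
  (∀ {a b} → R a b → f a ≡ f b) → ∀ {x xs y} → Linked R (x ∷ xs) → y ∈ x ∷ xs → f y ≡ f x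
linked-constant f preserved _ (here refl) = refl
linked-constant f preserved (Rxz ∷ rest) (there y∈zs) =
  trans (linked-constant f preserved rest y∈zs) (sym (preserved Rxz))

module _ {A : Set} where

  width : Node A → ℕ
  totalWidth : List (Node A) → ℕ
  width (leaf _ _) = 1
  width (inner _ _ _ cs) = totalWidth cs
  totalWidth [] = 0
  totalWidth (c ∷ cs) = width c + totalWidth cs

  totalWidth-++ : ∀ xs ys → totalWidth (xs ++ ys) ≡ totalWidth xs + totalWidth ys
  totalWidth-++ [] ys = refl
  totalWidth-++ (x ∷ xs) ys = trans (cong (width x +_) (totalWidth-++ xs ys))
                                    (sym (+-assoc (width x) _ _))

  width≤totalWidth : ∀ {c} cs → c ∈ cs → width c ≤ totalWidth cs
  width≤totalWidth (c ∷ cs) (here refl) = m≤m+n (width c) (totalWidth cs)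
  width≤totalWidth (c ∷ cs) (there c∈cs) =
    ≤-trans (width≤totalWidth cs c∈cs) (m≤n+m (totalWidth cs) (width c))

  totalWidth-uniform : ∀ w ys → (∀ {y} → y ∈ ys → width y ≡ w) → totalWidth ys ≡ length ys * w
  totalWidth-uniform w [] _ = refl
  totalWidth-uniform w (y ∷ ys) all-w =
    cong₂ _+_ (all-w (here refl)) (totalWidth-uniform w ys (λ y∈ys → all-w (there y∈ys)))

  totalWidth-cong : ∀ ys zs →
    (∀ {y z} → y ∈ ys → z ∈ zs → hashOf y ≡ hashOf z → width y ≡ width z) →
    map hashOf ys ≡ map hashOf zs → totalWidth ys ≡ totalWidth zs
  totalWidth-cong [] [] _ _ = refl
  totalWidth-cong (y ∷ ys) (z ∷ zs) hash⇒width eq =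
    cong₂ _+_ (hash⇒width (here refl) (here refl) (∷-injectiveˡ eq))
              (totalWidth-cong ys zs (λ y∈ys z∈zs → hash⇒width (there y∈ys) (there z∈zs))
                               (∷-injectiveʳ eq))

  totalWidth-regroup : ∀ R (node : List⁺ (Node A) → Node A) →
    (∀ g → width (node g) ≡ totalWidth (toList g)) →
    ∀ xs → totalWidth (map node (groupRuns R xs)) ≡ totalWidth xs
  totalWidth-regroup R node node-width xs =
    trans (over-runs (groupRuns R xs)) (cong totalWidth (groupRuns-concat R xs))
    where
    over-runs : ∀ gs → totalWidth (map node gs) ≡ totalWidth (concat (map toList gs))
    over-runs [] = refl
    over-runs (g ∷ gs) = trans (cong₂ _+_ (node-width g) (over-runs gs))
                               (sym (totalWidth-++ (toList g) _))

  DupUniform : Node A → Set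
  DupUniform (inner dupK _ _ cs) = ∀ {c c′} → c ∈ cs → c′ ∈ cs → width c ≡ width c′
  DupUniform _ = ⊤

  -- A uniform duplicate node of degree k has width k · (width of any child).
  dupDegreeProduct≤width : ∀ {t p} → RootLeafPath t p → All DupUniform p →
                           dupDegreeProduct p ≤ width t
  dupDegreeProduct≤width atLeaf _ = ≤-refl
  dupDegreeProduct≤width (down {k = dupK} {cs = cs} {c = c} {p = p} c∈cs path) (uniform ∷ rest) =
    begin
      length cs * dupDegreeProduct p  ≤⟨ *-monoʳ-≤ (length cs) (dupDegreeProduct≤width path rest) ⟩
      length cs * width c             ≡⟨ sym (totalWidth-uniform (width c) cs (λ y∈cs → uniform y∈cs c∈cs)) ⟩
      totalWidth cs                   ∎
    where open Data.Nat.Properties.≤-Reasoning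
  dupDegreeProduct≤width (down {k = incK} {cs = cs} c∈cs path) (_ ∷ rest) =
    ≤-trans (dupDegreeProduct≤width path rest) (width≤totalWidth cs c∈cs)

module Levels {A : Set} {n : ℕ} (s : Vec A n) (h : HInput A → ℕ) where

  sameHash increasing : Node A → Node A → Bool
  sameHash u v = hashOf u ≡ᵇ hashOf v
  increasing u v = hashOf u <ᵇ hashOf v

  lv : ℕ → List (Node A)
  lv = level h s

  data BuiltFrom (ℓ : ℕ) : Node A → Set where
    dup : ∀ {g} → g ∈ groupRuns sameHash (lv ℓ) → BuiltFrom ℓ (dupNode h (suc ℓ) g)
    inc : ∀ {g} → g ∈ groupRuns increasing (lv ℓ) → BuiltFrom ℓ (incNode h (suc ℓ) g)

  builtFrom : ∀ ℓ {u} → u ∈ lv (suc ℓ) → BuiltFrom ℓ u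
  builtFrom ℓ u∈ with isDupLevel (suc ℓ)
  ... | true with ∈-map⁻ (dupNode h (suc ℓ)) u∈
  ...   | _ , g∈ , refl = dup g∈
  builtFrom ℓ u∈ | false with ∈-map⁻ (incNode h (suc ℓ)) u∈
  ...   | _ , g∈ , refl = inc g∈

  level₀-leaf : ∀ {u} → u ∈ lv 0 → ∃ λ a → u ≡ leaf a (h (chr a))
  level₀-leaf u∈ with ∈-map⁻ (λ a → leaf a (h (chr a))) {xs = Vec.toList s} u∈
  ... | a , _ , u≡ = a , u≡

  child-∈ : ∀ ℓ {k i x cs c} → inner k i x cs ∈ lv (suc ℓ) → c ∈ cs → c ∈ lv ℓ
  child-∈ ℓ t∈ c∈ with builtFrom ℓ t∈
  ... | dup g∈ = groupRuns-∈ sameHash (lv ℓ) g∈ c∈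
  ... | inc g∈ = groupRuns-∈ increasing (lv ℓ) g∈ c∈

  sameHash-run : ∀ ℓ {g y} → g ∈ groupRuns sameHash (lv ℓ) → y ∈ toList g →
                 hashOf y ≡ hashOf (L⁺.head g)
  sameHash-run ℓ g∈ y∈ =
    linked-constant hashOf (λ {a} {b} eq → ≡ᵇ⇒≡ (hashOf a) (hashOf b) eq)
                    (All.lookup (groupRuns-linked sameHash (lv ℓ)) g∈) y∈

  totalWidth-leaves : ∀ {m} (t : Vec A m) → totalWidth (leaves h t) ≡ m
  totalWidth-leaves Vec.[] = refl
  totalWidth-leaves (a Vec.∷ t) = cong suc (totalWidth-leaves t)

  totalWidth-level : ∀ ℓ → totalWidth (lv ℓ) ≡ n
  totalWidth-level zero = totalWidth-leaves s
  totalWidth-level (suc ℓ) with isDupLevel (suc ℓ)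
  ... | true  = trans (totalWidth-regroup sameHash (dupNode h (suc ℓ)) (λ _ → refl) (lv ℓ))
                      (totalWidth-level ℓ)
  ... | false = trans (totalWidth-regroup increasing (incNode h (suc ℓ)) (λ _ → refl) (lv ℓ))
                      (totalWidth-level ℓ)

  width-root : ∀ L {root} → lv L ≡ root ∷ [] → width root ≡ n
  width-root L {root} level-L = begin
    width root                ≡⟨ sym (+-identityʳ (width root)) ⟩
    totalWidth (root ∷ [])    ≡⟨ cong totalWidth (sym level-L) ⟩
    totalWidth (lv L)         ≡⟨ totalWidth-level L ⟩
    n                         ∎
    where open ≡-Reasoning

  HashDeterminesWidth : ℕ → Set
  HashDeterminesWidth ℓ = ∀ {u v} → u ∈ lv ℓ → v ∈ lv ℓ → hashOf u ≡ hashOf v → width u ≡ width v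

  run-width : ∀ ℓ → HashDeterminesWidth ℓ → ∀ {g y} → g ∈ groupRuns sameHash (lv ℓ) →
              y ∈ toList g → width y ≡ width (L⁺.head g)
  run-width ℓ hash⇒width g∈ y∈ =
    hash⇒width (groupRuns-∈ sameHash (lv ℓ) g∈ y∈) (groupRuns-∈ sameHash (lv ℓ) g∈ (here refl))
               (sameHash-run ℓ g∈ y∈)

  -- The fields of a hash input that collision-freeness lets us compare.
  degreeField firstHashField : HInput A → ℕ
  degreeField (dupI _ k _) = k
  degreeField _ = 0
  firstHashField (dupI _ _ x) = x
  firstHashField _ = 0

  childHashesField : HInput A → List ℕ
  childHashesField (incI _ xs) = xs
  childHashesField _ = []

  CollisionFree : ℕ → Set
  CollisionFree L = ∀ ℓ₁ ℓ₂ (u v : Node A) → ℓ₁ ≤ L → ℓ₂ ≤ L →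
    u ∈ lv ℓ₁ → v ∈ lv ℓ₂ → hashOf u ≡ hashOf v → inputOf u ≡ inputOf v

  module _ {L : ℕ} (cf : CollisionFree L) where

    -- Equal hashes mean equal hash inputs: for duplicate nodes the same degree
    -- and first-child hash (hence, inductively, equal-width children), for
    -- increasing nodes the same children hashes (hence equal-width children).
    hash⇒width : ∀ ℓ → ℓ ≤ L → HashDeterminesWidth ℓ
    hash⇒width zero _ u∈ v∈ _ with level₀-leaf u∈ | level₀-leaf v∈
    ... | _ , u≡ | _ , v≡ = trans (cong width u≡) (sym (cong width v≡))
    hash⇒width (suc ℓ) ℓ<L u∈ v∈ eq
      with builtFrom ℓ u∈ | builtFrom ℓ v∈ | cf _ _ _ _ ℓ<L ℓ<L u∈ v∈ eq
    ... | dup {g} g∈ | dup {g′} g′∈ | same-input = begin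
      totalWidth (toList g)                   ≡⟨ totalWidth-uniform _ _ (run-width ℓ ih g∈) ⟩
      length (toList g) * width (L⁺.head g)   ≡⟨ cong₂ _*_ (cong degreeField same-input) same-head-width ⟩
      length (toList g′) * width (L⁺.head g′) ≡⟨ sym (totalWidth-uniform _ _ (run-width ℓ ih g′∈)) ⟩
      totalWidth (toList g′)                  ∎
      where
      open ≡-Reasoning
      ih : HashDeterminesWidth ℓ
      ih = hash⇒width ℓ (≤-trans (n≤1+n ℓ) ℓ<L)
      same-head-width : width (L⁺.head g) ≡ width (L⁺.head g′)
      same-head-width = ih (groupRuns-∈ sameHash (lv ℓ) g∈ (here refl))
                           (groupRuns-∈ sameHash (lv ℓ) g′∈ (here refl))
                           (cong firstHashField same-input)
    ... | dup _ | inc _ | ()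
    ... | inc _ | dup _ | ()
    ... | inc {g} g∈ | inc {g′} g′∈ | same-input =
      totalWidth-cong (toList g) (toList g′)
        (λ y∈ z∈ → hash⇒width ℓ (≤-trans (n≤1+n ℓ) ℓ<L)
                     (groupRuns-∈ increasing (lv ℓ) g∈ y∈) (groupRuns-∈ increasing (lv ℓ) g′∈ z∈))
        (cong childHashesField same-input)

    level-dupUniform : ∀ ℓ → ℓ ≤ L → ∀ {t} → t ∈ lv ℓ → DupUniform t
    level-dupUniform zero _ t∈ with level₀-leaf t∈
    ... | _ , refl = _
    level-dupUniform (suc ℓ) ℓ<L t∈ with builtFrom ℓ t∈
    ... | dup g∈ = λ c∈ c′∈ → trans (run-width ℓ ih g∈ c∈) (sym (run-width ℓ ih g∈ c′∈))
      where ih = hash⇒width ℓ (≤-trans (n≤1+n ℓ) ℓ<L)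
    ... | inc _ = _

    path-dupUniform : ∀ ℓ → ℓ ≤ L → ∀ {t p} → t ∈ lv ℓ → RootLeafPath t p → All DupUniform p
    path-dupUniform _ _ _ atLeaf = _ ∷ []
    path-dupUniform zero _ t∈ (down _ _) with level₀-leaf t∈
    ... | _ , ()
    path-dupUniform (suc ℓ) ℓ<L t∈ (down c∈ path) =
      level-dupUniform (suc ℓ) ℓ<L t∈
        ∷ path-dupUniform ℓ (≤-trans (n≤1+n ℓ) ℓ<L) (child-∈ ℓ t∈ c∈) path

mainTheorem6 : (A : Set) (c : ℕ) →
    ∃[ C ] ∃[ N₀ ] (∀ (n : ℕ) → N₀ ≤ n →
    ∀ (s : Vec A n) (h : HInput A → ℕ) →
    (∀ x → h x < 2 ^ (c * ⌈log₂ n ⌉)) →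
    ∀ (L : ℕ) (root : Node A) →
    level h s L ≡ root ∷ [] →
    (∀ ℓ → ℓ < L → length (level h s ℓ) ≢ 1) →
    (∀ ℓ₁ ℓ₂ (u v : Node A) → ℓ₁ ≤ L → ℓ₂ ≤ L →
    u ∈ level h s ℓ₁ → v ∈ level h s ℓ₂ →
    hashOf u ≡ hashOf v → inputOf u ≡ inputOf v) →
    ∀ (p : List (Node A)) → RootLeafPath root p →
    dupDegreeProduct p ≤ n ^ C)
mainTheorem6 A c = 1 , 0 , λ n _ s h _ L root level-L _ cf p path →
  let open Levels s h
      root∈ : root ∈ lv L
      root∈ = subst (root ∈_) (sym level-L) (here refl)
      open Data.Nat.Properties.≤-Reasoning
  in begin
    dupDegreeProduct p  ≤⟨ dupDegreeProduct≤width path (path-dupUniform cf L ≤-refl root∈ path) ⟩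
    width root          ≡⟨ width-root L level-L ⟩
    n                   ≡⟨ sym (*-identityʳ n) ⟩
    n ^ 1               ∎
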